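{- Let $(Z_1,Z_\partial,I,R_\Box,R_\Diamond,T)$ be a separated frame whose relations are smooth. Then for every stable set $A\in\mathcal G(Z_1)$, \[ \blacksquare A=\{x\in Z_1:\ \forall z\in Z_1\,(xR''_\Box z\Rightarrow z\in A)\}. \] That is, $\blacksquare$ is the restriction to stable sets of the dual image operator generated on $\mathcal P(Z_1)$ by the relation $R''_\Box$.
   Context: A frame is a tuple $(Z_1,Z_\partial,I,R_\Box,R_\Diamond,T)$ with $Z_1,Z_\partial$ nonempty sets, $I\subseteq Z_1\times Z_\partial$, $R_\Box\subseteq Z_\partial\times Z_\partial$, $R_\Diamond\subseteq Z_1\times Z_1$, $T\subseteq Z_\partial\times Z_1\times Z_\partial$. Write $x\nmid y$ iff $(x,y)\notin I$ (the Galois relation). For $U\subseteq Z_1$ let $U'=\{y\in Z_\partial:\forall u\in U\ u\nmid y\}$, and for $V\subseteq Z_\partial$ let $V'=\{x\in Z_1:\forall v\in V\ x\nmid v\}$. A set $W$ (of either sort) is a Galois set if $W=W''$; Galois subsets of $Z_1$ are called stable and $\mathcal G(Z_1)$ is the complete lattice of stable sets ordered by inclusion. On each sort put $u\preceq w$ iff $\{u\}'\subseteq\{w\}'$; the frame is separated if $\preceq$ is a partial order. For a relation $R\subseteq Z_{s_0}\times Z_{s_1}\times\cdots\times Z_{s_n}$ and a tuple $\vec u$, let $R\vec u=\{w: wR\vec u\}$; the Galois dual $R'$ is defined by $wR'\vec u$ iff $w\in (R\vec u)'$, and $R$ is smooth if every section of $R'$ (the set obtained by fixing all coordinates but one) is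 a Galois set. Define $R'_\Box\subseteq Z_1\times Z_\partial$ by $xR'_\Box v$ iff $\forall y\in Z_\partial\,(yR_\Box v\Rightarrow x\nmid y)$, and $R''_\Box\subseteq Z_1\times Z_1$ by $xR''_\Box z$ iff $\forall v\in Z_\partial\,(xR'_\Box v\Rightarrow z\nmid v)$. For $A\in\mathcal G(Z_1)$ define $\blacksquare A=\big(\{v\in Z_\partial:\exists y\in A'\ vR_\Box y\}\big)'$. -}

module Defs where

open import Level using (0ℓ)
open import Data.Product using (_×_; Σ; ∃; _,_)
open import Relation.Nullary using (¬_)
open import Relation.Binary.PropositionalEquality using (_≡_)
open import Relation.Unary using (Pred; _≐_; _∈_)

record Frame : Set₁ where
  field
    Z₁ : Set
    Z∂ : Set
    z₁ : Z₁          -- nonemptiness witnesses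
    z∂ : Z∂
    I  : Z₁ → Z∂ → Set
    R□ : Z∂ → Z∂ → Set
    R◇ : Z₁ → Z₁ → Set
    T  : Z∂ → Z₁ → Z∂ → Set

module _ (F : Frame) where
  open Frame F

  _∤_ : Z₁ → Z∂ → Set
  x ∤ y = ¬ I x y

  ′₁ : Pred Z₁ 0ℓ → Pred Z∂ 0ℓ
  ′₁ U y = ∀ u → U u → u ∤ y

  ′∂ : Pred Z∂ 0ℓ → Pred Z₁ 0ℓ
  ′∂ V x = ∀ v → V v → x ∤ v

  Galois₁ : Pred Z₁ 0ℓ → Set
  Galois₁ U = U ≐ ′∂ (′₁ U)

  Galois∂ : Pred Z∂ 0ℓ → Set
  Galois∂ V = V ≐ ′₁ (′∂ V)

  Stable : Pred Z₁ 0ℓ → Set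
  Stable = Galois₁

  _⪯₁_ : Z₁ → Z₁ → Set
  u ⪯₁ w = ∀ y → ′₁ (_≡_ u) y → ′₁ (_≡_ w) y

  _⪯∂_ : Z∂ → Z∂ → Set
  u ⪯∂ w = ∀ x → ′∂ (_≡_ u) x → ′∂ (_≡_ w) x

  -- separated: ⪯ is a partial order on each sort (it is always a preorder,
  -- so this amounts to antisymmetry)
  Separated : Set
  Separated = (∀ u w → u ⪯₁ w → w ⪯₁ u → u ≡ w)
            × (∀ u w → u ⪯∂ w → w ⪯∂ u → u ≡ w)

  R□′ : Z₁ → Z∂ → Set
  R□′ x v = ′∂ (λ y → R□ y v) x

  R◇′ : Z∂ → Z₁ → Set
  R◇′ y z = ′₁ (λ x → R◇ x z) y

  T′ : Z₁ → Z₁ → Z∂ → Set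
  T′ w x v = ′∂ (λ y → T y x v) w

  SmoothR□ : Set
  SmoothR□ = (∀ v → Galois₁ (λ x → R□′ x v))
           × (∀ x → Galois∂ (λ v → R□′ x v))

  SmoothR◇ : Set
  SmoothR◇ = (∀ z → Galois∂ (λ y → R◇′ y z))
           × (∀ y → Galois₁ (λ z → R◇′ y z))

  SmoothT : Set
  SmoothT = (∀ x v → Galois₁ (λ w → T′ w x v))
          × (∀ w v → Galois₁ (λ x → T′ w x v))
          × (∀ w x → Galois∂ (λ v → T′ w x v))

  Smooth : Set
  Smooth = SmoothR□ × SmoothR◇ × SmoothT

  R□″ : Z₁ → Z₁ → Set
  R□″ x z = ∀ v → R□′ x v → z ∤ v

  ■ : Pred Z₁ 0ℓ → Pred Z₁ 0ℓ
  ■ A = ′∂ (λ v → Σ Z∂ (λ y → ′₁ A y × R□ v y))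

  [R□″] : Pred Z₁ 0ℓ → Pred Z₁ 0ℓ
  [R□″] A x = ∀ z → R□″ x z → A z

{-# OPTIONS --safe #-}
-- A point x lies in ■A iff every y ∈ A' satisfies x R□' y, and R□'' x is by
-- definition the Galois dual (R□' x)' of the section R□' x.  Hence ■A ⊆ [R□''] A''
-- for every A, and stability of A gives ■A ⊆ [R□''] A.  Conversely, if R□'' x ⊆ A
-- then A' ⊆ (R□'' x)' = (R□' x)'', which is R□' x because smoothness makes this
-- section Galois.
module Submission where

open import Defs
open import Relation.Unary using (Pred; _≐_; _⊆_)
open import Level using (0ℓ)
open import Data.Product using (_,_; proj₂)
open import Function using (_∘_)

module _ (F : Frame) where
  open Frame F

  [R□″]-mono : {A B : Pred Z₁ 0ℓ} → A ⊆ B → [R□″] F A ⊆ [R□″] F B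
  [R□″]-mono A⊆B x∈[R□″]A z xR□″z = A⊆B (x∈[R□″]A z xR□″z)

  ■⊆[R□″]-closure : (A : Pred Z₁ 0ℓ) → ■ F A ⊆ [R□″] F (′∂ F (′₁ F A))
  ■⊆[R□″]-closure A {x} x∈■A z xR□″z y y∈A′ = xR□″z y xR□′y
    where
    xR□′y : R□′ F x y
    xR□′y v vR□y = x∈■A v (y , y∈A′ , vR□y)

  [R□″]⊆■ : (∀ x → Galois∂ F (R□′ F x)) → (A : Pred Z₁ 0ℓ) → [R□″] F A ⊆ ■ F A
  [R□″]⊆■ galois A {x} x∈[R□″]A v (y , y∈A′ , vR□y) = xR□′y v vR□y
    where
    xR□′y : R□′ F x y
    xR□′y = proj₂ (galois x) (λ z xR□″z → y∈A′ z (x∈[R□″]A z xR□″z))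

proposition3p13 : (F : Frame) → Separated F → Smooth F →
    (A : Pred (Frame.Z₁ F) 0ℓ) → Stable F A →
    ■ F A ≐ [R□″] F A
proposition3p13 F _ ((_ , galois) , _) A (_ , A″⊆A) =
  [R□″]-mono F A″⊆A ∘ ■⊆[R□″]-closure F A , [R□″]⊆■ F galois A
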